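{- For any instance of Cap-SNDP with multiple copies, the total cost of all edges (with multiplicity) bought by the algorithm Cap-SNDP-MC is at most $9\sum_{i=1}^k \ell_i$.
   Context: Cap-SNDP with multiple copies: an undirected multigraph $G=(V,E)$ with edge costs $c(e)\ge0$ and integer capacities $u(e)>0$, and $k$ terminal pairs $(s_1,t_1),\dots,(s_k,t_k)$ with requirements $R_1\ge R_2\ge\dots\ge R_k>0$; one may buy $\alpha_e\in\mathbb{Z}_{\ge0}$ copies of each edge $e$ at cost $\alpha_e c(e)$, giving capacity $\alpha_e u(e)$. Algorithm Cap-SNDP-MC: start with $F=\emptyset$. For $i=1,\dots,k$: set $c_i(e)=0$ for $e\in F$ and $c_i(e)=c(e)+\frac{R_i}{u(e)}c(e)$ for $e\notin F$; let $d_i$ be the shortest-path distance with respect to $c_i$ (for a vertex set $X$, $d_i(v,X)=\min_{w\in X}d_i(v,w)$); let $\ell_i=d_i(s_i,t_i)$, add to $F$ a shortest $s_i$-$t_i$ path under $c_i$, and set $\mathrm{class}(i)=\lfloor\log_2\ell_i\rfloor$. For a connected component $X$ of $F$, $\mathrm{class}(X)=\max\{\mathrm{class}(j): (s_j,t_j)\in X\}$. Then for each connected component $X$ of $F$, if $d_i(s_i,X)\le 2^{\min\{\mathrm{class}(i),\mathrm{class}(X)\}}$, add to $F$ a shortest path connecting $s_i$ and $X$; then for each connected component $X$ of $F$, if $d_i(t_i,X)\le 2^{\min\{\mathrm{class}(i),\mathrm{class}(X)\}}$, add to $F$ a shortest path connecting $t_i$ and $X$. Finally buy $\lceil R_i/u(e)\rceil$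 copies of each edge $e$ added to $F$ during iteration $i$. The algorithm outputs these copies.
   Formalization: The edge costs c(e) are nonnegative rationals. -}

module Defs where

open import Data.Nat as ℕ using (ℕ; zero; suc; >-nonZero)
open import Data.Nat.DivMod as ℕD using ()
open import Data.Nat.Properties using (m^n≢0)
open import Data.Integer as ℤ using (ℤ; +_; -[1+_])
open import Data.Rational as ℚ using (ℚ; 0ℚ; 1ℚ; ½)
open import Data.Fin as Fin using (Fin; toℕ)
open import Data.Fin.Subset as Sub using (Subset; _∈_; _∪_; _∩_; ∁; ⁅_⁆; ⋃)
open import Data.Fin.Subset.Properties using (_∈?_)
open import Data.List as List using (List; []; _∷_; map; foldr; allFin)
open import Data.List.Relation.Unary.All using (All)
open import Data.List.Relation.Unary.Unique.Propositional using (Unique)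
open import Data.Maybe using (Maybe; just; nothing)
open import Data.Product using (Σ; ∃; ∃-syntax; _×_; _,_; proj₁; proj₂)
open import Data.Sum using (_⊎_)
open import Data.Bool using (if_then_else_)
open import Relation.Nullary using (¬_; does)
open import Relation.Binary.PropositionalEquality using (_≡_)

-- Terminal pairs indexed by Fin k; index i corresponds to pair i+1 of the
-- paper, so the processing order 1..k is the order of Fin k.

record Instance : Set where
  field
    n m k : ℕ
    ends  : Fin m → Fin n × Fin n
    c     : Fin m → ℚ
    c≥0   : ∀ e → 0ℚ ℚ.≤ c e
    u     : Fin m → ℕ
    u>0   : ∀ e → 0 ℕ.< u e
    s t   : Fin k → Fin n
    R     : Fin k → ℕ
    R>0   : ∀ i → 0 ℕ.< R i
    R-mono : ∀ (i j : Fin k) → toℕ i ℕ.≤ toℕ j → R j ℕ.≤ R i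

Σℚ : ∀ {a} → (Fin a → ℚ) → ℚ
Σℚ {a} f = foldr ℚ._+_ 0ℚ (map f (allFin a))

pow2 : ℤ → ℚ
pow2 (+ k)      = (+ (2 ℕ.^ k)) ℚ./ 1
pow2 (-[1+ k ]) = ((+ 1) ℚ./ (2 ℕ.^ suc k)) {{m^n≢0 2 (suc k)}}

-- classes live in ℤ ∪ {-∞}; nothing represents -∞ = ⌊log₂ 0⌋
Class : Set
Class = Maybe ℤ

-- 2^class, with 2^(-∞) = 0
thr : Class → ℚ
thr nothing  = 0ℚ
thr (just z) = pow2 z

minC : Class → Class → Class
minC nothing  _        = nothing
minC (just _) nothing  = nothing
minC (just a) (just b) = just (a ℤ.⊓ b)

data _≤C_ : Class → Class → Set where
  -∞≤ : ∀ {κ} → nothing ≤C κ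
  j≤j : ∀ {a b} → a ℤ.≤ b → just a ≤C just b

FloorLog2 : ℚ → Class → Set
FloorLog2 ℓ κ =
  (ℓ ≡ 0ℚ × κ ≡ nothing)
  ⊎ (∃[ z ] (κ ≡ just z × pow2 z ℚ.≤ ℓ × ℓ ℚ.< pow2 (z ℤ.+ + 1)))

module _ (I : Instance) where
  open Instance I

  Joins : Fin m → Fin n → Fin n → Set
  Joins e v w = ends e ≡ (v , w) ⊎ ends e ≡ (w , v)

  data Walk : Fin n → Fin n → Set where
    []  : ∀ {v} → Walk v v
    _∷⟨_⟩_ : ∀ {v x w} (e : Fin m) → Joins e v x → Walk x w → Walk v w

  edgesW : ∀ {v w} → Walk v w → List (Fin m)
  edgesW []             = []
  edgesW (e ∷⟨ _ ⟩ p)   = e ∷ edgesW p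

  vertsW : ∀ {v w} → Walk v w → List (Fin n)
  vertsW {v} []           = v ∷ []
  vertsW {v} (e ∷⟨ _ ⟩ p) = v ∷ vertsW p

  Path : Fin n → Fin n → Set
  Path v w = Σ (Walk v w) (λ p → Unique (vertsW p))

  edgeSet : ∀ {v w} → Path v w → Subset m
  edgeSet p = ⋃ (map ⁅_⁆ (edgesW (proj₁ p)))

  pcost : (Fin m → ℚ) → ∀ {v w} → Path v w → ℚ
  pcost w p = foldr ℚ._+_ 0ℚ (map w (edgesW (proj₁ p)))

  ci : Subset m → Fin k → Fin m → ℚ
  ci F i e =
    if does (e ∈? F) then 0ℚ
    else (c e ℚ.+ (((+ R i) ℚ./ u e) {{>-nonZero (u>0 e)}}) ℚ.* c e)

  -- ⌈ R / u(e) ⌉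
  copies : Fin k → Fin m → ℕ
  copies i e = ((R i ℕ.+ u e ℕ.∸ 1) ℕD./ u e) {{>-nonZero (u>0 e)}}

  Reach : Subset m → Fin n → Fin n → Set
  Reach F v w = Σ (Walk v w) (λ p → All (_∈ F) (edgesW p))

  VSet : Set₁
  VSet = Fin n → Set

  comp : Subset m → Fin n → VSet
  comp F v w = Reach F v w

  IsRep : Subset m → Fin n → Set
  IsRep F v = ∀ w → Reach F v w → toℕ v ℕ.≤ toℕ w

  DistLe : (Fin m → ℚ) → Fin n → VSet → ℚ → Set
  DistLe wt x X b = ∃[ y ] (X y × Σ (Path x y) (λ p → pcost wt p ℚ.≤ b))

  ShortestTo : (Fin m → ℚ) → (x : Fin n) → VSet → ∀ {y} → Path x y → Set
  ShortestTo wt x X {y} p =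
    X y × (∀ y' → X y' → (q : Path x y') → pcost wt p ℚ.≤ pcost wt q)

  -- class(X) = max{ class(j) : j processed (j ≤ i), s_j, t_j ∈ X }, max ∅ = -∞
  IsCompClass : (Fin k → Class) → Fin k → VSet → Class → Set
  IsCompClass cls i X κ =
    (∀ (j : Fin k) → toℕ j ℕ.≤ toℕ i → X (s j) → X (t j) → cls j ≤C κ)
    × (κ ≡ nothing
       ⊎ ∃[ j ] (toℕ j ℕ.≤ toℕ i × X (s j) × X (t j) × cls j ≡ κ))

  -- One "for each connected component X of F" step of iteration i for
  -- terminal x (x = s_i or t_i): the components are those of F (fixed when
  -- the step starts), indexed by their representatives.  The edge set added
  -- for the component with representative v is E v; B is the total.
  CompChoice : Subset m → (Fin m → ℚ) → (Fin k → Class) → Fin k → Fin n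
             → Fin n → Subset m → Set
  CompChoice F wt cls i x v E =
    (IsRep F v × ∃[ κ ] (IsCompClass cls i (comp F v) κ ×
       ((DistLe wt x (comp F v) (thr (minC (cls i) κ))
          × ∃[ y ] Σ (Path x y) (λ p → ShortestTo wt x (comp F v) p × E ≡ edgeSet p))
        ⊎ (¬ DistLe wt x (comp F v) (thr (minC (cls i) κ)) × E ≡ Sub.⊥))))
    ⊎ (¬ IsRep F v × E ≡ Sub.⊥)

  CompStep : Subset m → (Fin m → ℚ) → (Fin k → Class) → Fin k → Fin n
           → Subset m → Set
  CompStep F wt cls i x B =
    ∃[ E ] ((∀ v → CompChoice F wt cls i x v (E v))
            × B ≡ ⋃ (map E (allFin n)))

  Fbefore : (Fin k → Subset m) → Fin k → Subset m
  Fbefore A i = ⋃ (List.filter (λ j → toℕ j ℕ.<? toℕ i) (allFin k) |> map A)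
    where
      _|>_ : ∀ {X Y : Set} → X → (X → Y) → Y
      x |> f = f x
      infixl 1 _|>_

  Iteration : (Fin k → Subset m) → (Fin k → ℚ) → (Fin k → Class) → Fin k → Set
  Iteration A ℓ cls i =
    let F  = Fbefore A i
        wt = ci F i
    in Σ (Path (s i) (t i)) λ P →
         ShortestTo wt (s i) (λ y → y ≡ t i) P
       × ℓ i ≡ pcost wt P
       × FloorLog2 (ℓ i) (cls i)
       × ∃[ Bs ] (CompStep (F ∪ edgeSet P) wt cls i (s i) Bs
       × ∃[ Bt ] (CompStep (F ∪ edgeSet P ∪ Bs) wt cls i (t i) Bt
       × A i ≡ (edgeSet P ∪ Bs ∪ Bt) ∩ ∁ F))

  record Run : Set where
    field
      A    : Fin k → Subset m
      ℓ    : Fin k → ℚ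
      cls  : Fin k → Class
      step : ∀ i → Iteration A ℓ cls i

  totalCost : Run → ℚ
  totalCost r =
    Σℚ (λ i → Σℚ (λ e →
      if does (e ∈? Run.A r i)
      then ((+ copies i e) ℚ./ 1) ℚ.* c e
      else 0ℚ))

  sumℓ : Run → ℚ
  sumℓ r = Σℚ (Run.ℓ r)

module Submission where

-- Cost of Cap-SNDP-MC.  We prove the stronger bound  cost ≤ 2·Σᵢ ℓᵢ,  from
-- which  cost ≤ 9·Σᵢ ℓᵢ  follows because every ℓᵢ is nonnegative.
--
-- Buying ⌈Rᵢ/u(e)⌉ copies of e costs at most the modified cost cᵢ(e)
-- (ceil-cost-≤), so iteration i costs at most ℓᵢ, for the shortest path Pᵢ,
-- plus the modified costs of the paths joining sᵢ and tᵢ to components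
-- (iteration-cost).  These are paid by a potential (module Potential): with
-- weights f j = 2^class(j), it sums over the components of the current graph
-- the largest weight of a connected pair inside.  A path to a component X
-- costs at most 2^min(class(i), class(X)), and merging all components reached
-- from sᵢ (or tᵢ) lowers the potential by at least the total of these costs
-- (Growth.Merge.merge); buying edges never raises it (Φ-antitone) and
-- admitting pair i raises it by at most 2^class(i) ≤ ℓᵢ (Φ-suc).  Telescoping
-- over the iterations bounds all connections by Σᵢ ℓᵢ (connections-cost).
-- The potential needs decidable reachability; as the final inequality is
-- decidable, such deciders may be assumed under a double negation.

open import Defs
open import Data.Integer using (+_)
open import Data.Rational using (_/_; _*_; _≤_)

open import Data.Bool using (Bool; true; false; if_then_else_)
open import Data.Empty using (⊥-elim)
import Data.Empty.Irrelevant as Irrelevant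
open import Data.Fin as Fin using (Fin; zero; suc; toℕ)
import Data.Fin.Properties as FinP
open import Data.Fin.Subset as Subset using (Subset; _∈_; _∪_; _∩_; ∁; ⁅_⁆; ⋃; _⊆_)
import Data.Fin.Subset.Properties as SubsetP
open import Data.Fin.Subset.Properties using (_∈?_)
open import Data.Integer as ℤ using (ℤ; -[1+_])
import Data.Integer.Properties as ℤP
open import Data.List using (List; []; _∷_; map; foldr; allFin; tabulate; filter)
open import Data.List.Membership.Propositional using () renaming (_∈_ to _∈ˡ_)
open import Data.List.Membership.Propositional.Properties using (∈-filter⁺; ∈-filter⁻; ∈-allFin)
open import Data.List.Properties using (map-tabulate)
open import Data.List.Relation.Unary.All as All using (All; []; _∷_)
open import Data.List.Relation.Unary.AllPairs using ([]; _∷_)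
open import Data.List.Relation.Unary.Any using (here; there)
open import Data.Maybe using (nothing; just)
open import Data.Nat as ℕ using (ℕ)
import Data.Nat.DivMod as ℕD
import Data.Nat.Properties as ℕP
open import Data.Product using (∃-syntax; _×_; _,_; proj₁; proj₂)
open import Data.Rational as ℚ using (ℚ; 0ℚ; 1ℚ; _+_; _<_; toℚᵘ)
import Data.Rational.Properties as ℚP
open import Data.Rational.Unnormalised as ℚᵘ using (mkℚᵘ)
import Data.Rational.Unnormalised.Properties as ℚᵘP
open import Data.Sum using (_⊎_; inj₁; inj₂; map₂)
open import Function using (_∘_; id)
open import Relation.Binary.Definitions using (tri<; tri≈; tri>)
open import Relation.Binary.PropositionalEquality
open import Relation.Nullary using (Dec; yes; no; does; ¬_)
open import Relation.Nullary.Decidable using (decidable-stable; ¬¬-excluded-middle; _×-dec_; _⊎-dec_; _→-dec_; ¬?)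
open import Relation.Nullary.Negation using (¬¬-map)

open import Algebra.Properties.CommutativeMonoid.Sum ℚP.+-0-commutativeMonoid
  using (sum; sum-cong-≗; ∑-distrib-+; ∑-comm; sum-replicate-zero)

Σℚ≡sum : ∀ {a} (f : Fin a → ℚ) → Σℚ f ≡ sum f
Σℚ≡sum f = trans (cong (foldr _+_ 0ℚ) (map-tabulate id f)) (foldr-tabulate f)
  where
  foldr-tabulate : ∀ {a} (g : Fin a → ℚ) → foldr _+_ 0ℚ (tabulate g) ≡ sum g
  foldr-tabulate {ℕ.zero} g = refl
  foldr-tabulate {ℕ.suc a} g = cong (_+_ (g zero)) (foldr-tabulate (g ∘ suc))

sum-mono : ∀ {a} {f g : Fin a → ℚ} → (∀ x → f x ≤ g x) → sum f ≤ sum g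
sum-mono {ℕ.zero} _ = ℚP.≤-refl
sum-mono {ℕ.suc a} f≤g = ℚP.+-mono-≤ (f≤g zero) (sum-mono (f≤g ∘ suc))

sum-nonneg : ∀ {a} {f : Fin a → ℚ} → (∀ x → 0ℚ ≤ f x) → 0ℚ ≤ sum f
sum-nonneg {a} f≥0 = ℚP.≤-trans (ℚP.≤-reflexive (sym (sum-replicate-zero a))) (sum-mono f≥0)

≤-+-nonneg : ∀ p {q} → 0ℚ ≤ q → p ≤ p + q
≤-+-nonneg p {q} q≥0 = ℚP.≤-trans (ℚP.≤-reflexive (sym (ℚP.+-identityʳ p))) (ℚP.+-monoʳ-≤ p q≥0)

term≤sum : ∀ {a} {f : Fin a → ℚ} → (∀ x → 0ℚ ≤ f x) → ∀ w → f w ≤ sum f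
term≤sum {f = f} f≥0 zero = ≤-+-nonneg (f zero) (sum-nonneg (f≥0 ∘ suc))
term≤sum {f = f} f≥0 (suc w) =
  ℚP.≤-trans (ℚP.≤-reflexive (sym (ℚP.+-identityˡ (f (suc w)))))
             (ℚP.+-mono-≤ (f≥0 zero) (term≤sum (f≥0 ∘ suc) w))

[_]·_ : Bool → ℚ → ℚ
[ b ]· q = if b then q else 0ℚ

[]·-nonneg : ∀ b {q} → 0ℚ ≤ q → 0ℚ ≤ [ b ]· q
[]·-nonneg true q≥0 = q≥0
[]·-nonneg false _ = ℚP.≤-refl

sum-point : ∀ {a} (w : Fin a) (q : ℚ) → sum (λ v → [ does (v Fin.≟ w) ]· q) ≡ q
sum-point {ℕ.suc a} zero q = trans (cong (_+_ q) (sum-replicate-zero a)) (ℚP.+-identityʳ q)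
sum-point (suc w) q = trans (ℚP.+-identityˡ _) (sum-point w q)

frac-≤ : ∀ a b c d .{{_ : ℕ.NonZero b}} .{{_ : ℕ.NonZero d}} →
         a ℕ.* d ℕ.≤ c ℕ.* b → (+ a) / b ≤ (+ c) / d
frac-≤ a (ℕ.suc b) c (ℕ.suc d) ad≤cb = ℚP.toℚᵘ-cancel-≤ (begin
  toℚᵘ ((+ a) / ℕ.suc b)  ≃⟨ ℚP.toℚᵘ-fromℚᵘ (mkℚᵘ (+ a) b) ⟩
  mkℚᵘ (+ a) b               ≤⟨ ℚᵘ.*≤* (subst₂ ℤ._≤_ (ℤP.pos-* a (ℕ.suc d)) (ℤP.pos-* c (ℕ.suc b)) (ℤ.+≤+ ad≤cb)) ⟩
  mkℚᵘ (+ c) d               ≃⟨ ℚᵘP.≃-sym (ℚP.toℚᵘ-fromℚᵘ (mkℚᵘ (+ c) d)) ⟩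
  toℚᵘ ((+ c) / ℕ.suc d)  ∎)
  where open ℚᵘP.≤-Reasoning
frac-≤ _ ℕ.zero _ _ {{b≢0}} _ = Irrelevant.⊥-elim (ℕ.≢-nonZero⁻¹ 0 {{b≢0}} refl)
frac-≤ _ (ℕ.suc _) _ ℕ.zero {{_}} {{d≢0}} _ = Irrelevant.⊥-elim (ℕ.≢-nonZero⁻¹ 0 {{d≢0}} refl)

/-split : ∀ R u .{{_ : ℕ.NonZero u}} → (+ (u ℕ.+ R)) / u ≡ 1ℚ + (+ R) / u
/-split R (ℕ.suc u) = ℚP.toℚᵘ-injective split
  where
  cross : + (ℕ.suc u ℕ.+ R) ℤ.* + ℕ.suc (u ℕ.+ 0)
        ≡ (+ 1 ℤ.* + ℕ.suc u ℤ.+ + R ℤ.* + 1) ℤ.* + ℕ.suc u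
  cross = begin
    + (ℕ.suc u ℕ.+ R) ℤ.* + ℕ.suc (u ℕ.+ 0)  ≡⟨ cong (λ v → + (ℕ.suc u ℕ.+ R) ℤ.* + ℕ.suc v) (ℕP.+-identityʳ u) ⟩
    + (ℕ.suc u ℕ.+ R) ℤ.* + ℕ.suc u          ≡⟨ cong (ℤ._* + ℕ.suc u) (ℤP.pos-+ (ℕ.suc u) R) ⟩
    (+ ℕ.suc u ℤ.+ + R) ℤ.* + ℕ.suc u        ≡⟨ cong (ℤ._* + ℕ.suc u) (cong₂ ℤ._+_ (sym (ℤP.*-identityˡ (+ ℕ.suc u))) (sym (ℤP.*-identityʳ (+ R)))) ⟩
    (+ 1 ℤ.* + ℕ.suc u ℤ.+ + R ℤ.* + 1) ℤ.* + ℕ.suc u ∎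
    where open ≡-Reasoning
  split : toℚᵘ ((+ (ℕ.suc u ℕ.+ R)) / ℕ.suc u) ℚᵘ.≃ toℚᵘ (1ℚ + (+ R) / ℕ.suc u)
  split = begin-equality
    toℚᵘ ((+ (ℕ.suc u ℕ.+ R)) / ℕ.suc u)        ≃⟨ ℚP.toℚᵘ-fromℚᵘ (mkℚᵘ (+ (ℕ.suc u ℕ.+ R)) u) ⟩
    mkℚᵘ (+ (ℕ.suc u ℕ.+ R)) u                  ≃⟨ ℚᵘ.*≡* cross ⟩
    mkℚᵘ (+ 1) 0 ℚᵘ.+ mkℚᵘ (+ R) u              ≃⟨ ℚᵘP.+-congʳ (mkℚᵘ (+ 1) 0) (ℚᵘP.≃-sym (ℚP.toℚᵘ-fromℚᵘ (mkℚᵘ (+ R) u))) ⟩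
    toℚᵘ 1ℚ ℚᵘ.+ toℚᵘ ((+ R) / ℕ.suc u)         ≃⟨ ℚᵘP.≃-sym (ℚP.toℚᵘ-homo-+ 1ℚ ((+ R) / ℕ.suc u)) ⟩
    toℚᵘ (1ℚ + (+ R) / ℕ.suc u)                 ∎
    where open ℚᵘP.≤-Reasoning

-- ⌈R/u⌉·c ≤ c + (R/u)·c for c ≥ 0, where ⌈R/u⌉ = (R + u ∸ 1) div u:
-- buying ⌈R/u⌉ copies of an edge costs at most its modified cost.
ceil-cost-≤ : ∀ R u .{{_ : ℕ.NonZero u}} (c : ℚ) → 0ℚ ≤ c →
  ((+ ((R ℕ.+ u ℕ.∸ 1) ℕD./ u)) / 1) * c ≤ c + ((+ R) / u) * c
ceil-cost-≤ R u c c≥0 = begin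
  (+ q / 1) * c              ≤⟨ ℚP.*-monoʳ-≤-nonNeg c {{ℚ.nonNegative c≥0}} q≤1+R/u ⟩
  (1ℚ + (+ R) / u) * c       ≡⟨ ℚP.*-distribʳ-+ c 1ℚ ((+ R) / u) ⟩
  1ℚ * c + ((+ R) / u) * c   ≡⟨ cong (_+ ((+ R) / u) * c) (ℚP.*-identityˡ c) ⟩
  c + ((+ R) / u) * c        ∎
  where
  open ℚP.≤-Reasoning
  q : ℕ
  q = (R ℕ.+ u ℕ.∸ 1) ℕD./ u
  qu≤u+R : q ℕ.* u ℕ.≤ (u ℕ.+ R) ℕ.* 1
  qu≤u+R = ℕP.≤-trans (ℕD.m/n*n≤m (R ℕ.+ u ℕ.∸ 1) u)
             (ℕP.≤-trans (ℕP.m∸n≤m (R ℕ.+ u) 1)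
               (ℕP.≤-reflexive (trans (ℕP.+-comm R u) (sym (ℕP.*-identityʳ (u ℕ.+ R))))))
  q≤1+R/u : (+ q) / 1 ≤ 1ℚ + (+ R) / u
  q≤1+R/u = ℚP.≤-trans (frac-≤ q 1 (u ℕ.+ R) u qu≤u+R) (ℚP.≤-reflexive (/-split R u))

frac-nonneg : ∀ a b .{{_ : ℕ.NonZero b}} → 0ℚ ≤ (+ a) / b
frac-nonneg a b = ℚP.nonNegative⁻¹ ((+ a) / b) {{ℚP.normalize-nonNeg a b}}

double-≤-nine-times : ∀ x → 0ℚ ≤ x → x + x ≤ ((+ 9) / 1) * x
double-≤-nine-times x x≥0 = begin
  x + x                ≡⟨ cong₂ _+_ (sym (ℚP.*-identityˡ x)) (sym (ℚP.*-identityˡ x)) ⟩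
  1ℚ * x + 1ℚ * x      ≡⟨ sym (ℚP.*-distribʳ-+ x 1ℚ 1ℚ) ⟩
  (1ℚ + 1ℚ) * x        ≤⟨ ℚP.*-monoʳ-≤-nonNeg x {{ℚ.nonNegative x≥0}} (frac-≤ 2 1 9 1 (ℕ.s≤s (ℕ.s≤s ℕ.z≤n))) ⟩
  ((+ 9) / 1) * x      ∎
  where open ℚP.≤-Reasoning

*-nonneg : ∀ {p q} → 0ℚ ≤ p → 0ℚ ≤ q → 0ℚ ≤ p * q
*-nonneg {p} {q} p≥0 q≥0 = ℚP.≤-trans (ℚP.≤-reflexive (sym (ℚP.*-zeroˡ q))) (ℚP.*-monoʳ-≤-nonNeg q {{ℚ.nonNegative q≥0}} p≥0)

pow2-nonneg : ∀ z → 0ℚ ≤ pow2 z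
pow2-nonneg (+ k) = frac-nonneg (2 ℕ.^ k) 1
pow2-nonneg -[1+ k ] = frac-nonneg 1 (2 ℕ.^ ℕ.suc k) {{ℕP.m^n≢0 2 (ℕ.suc k)}}

pow2-mono : ∀ {a b} → a ℤ.≤ b → pow2 a ≤ pow2 b
pow2-mono {+ a} {+ b} (ℤ.+≤+ a≤b) =
  frac-≤ (2 ℕ.^ a) 1 (2 ℕ.^ b) 1 (ℕP.*-monoˡ-≤ 1 (ℕP.^-monoʳ-≤ 2 a≤b))
pow2-mono { -[1+ a ]} {+ b} _ =
  frac-≤ 1 (2 ℕ.^ ℕ.suc a) (2 ℕ.^ b) 1 {{ℕP.m^n≢0 2 (ℕ.suc a)}}
    (ℕP.*-mono-≤ (ℕP.m^n>0 2 b) (ℕP.m^n>0 2 (ℕ.suc a)))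
pow2-mono { -[1+ a ]} { -[1+ b ]} (ℤ.-≤- b≤a) =
  frac-≤ 1 (2 ℕ.^ ℕ.suc a) 1 (2 ℕ.^ ℕ.suc b) {{ℕP.m^n≢0 2 (ℕ.suc a)}} {{ℕP.m^n≢0 2 (ℕ.suc b)}}
    (ℕP.*-monoʳ-≤ 1 (ℕP.^-monoʳ-≤ 2 (ℕ.s≤s b≤a)))

thr-nonneg : ∀ κ → 0ℚ ≤ thr κ
thr-nonneg nothing = ℚP.≤-refl
thr-nonneg (just z) = pow2-nonneg z

thr-minˡ : ∀ κ κ' → thr (minC κ κ') ≤ thr κ
thr-minˡ nothing _ = ℚP.≤-refl
thr-minˡ (just z) nothing = pow2-nonneg z
thr-minˡ (just z) (just z') = pow2-mono (ℤP.i⊓j≤i z z')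

thr-minʳ : ∀ κ κ' → thr (minC κ κ') ≤ thr κ'
thr-minʳ nothing κ' = thr-nonneg κ'
thr-minʳ (just _) nothing = ℚP.≤-refl
thr-minʳ (just z) (just z') = pow2-mono (ℤP.i⊓j≤j z z')

thr-floor : ∀ {ℓ κ} → FloorLog2 ℓ κ → thr κ ≤ ℓ
thr-floor (inj₁ (refl , refl)) = ℚP.≤-refl
thr-floor (inj₂ (_ , refl , 2^z≤ℓ , _)) = 2^z≤ℓ

weight : ∀ {a} → (Fin a → ℚ) → Subset a → ℚ
weight w S = sum (λ e → [ does (e ∈? S) ]· w e)

weight-⊥ : ∀ {a} (w : Fin a → ℚ) → weight w Subset.⊥ ≡ 0ℚ
weight-⊥ {a} w = trans (sum-cong-≗ outside) (sum-replicate-zero a)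
  where
  outside : ∀ e → [ does (e ∈? Subset.⊥) ]· w e ≡ 0ℚ
  outside e with e ∈? Subset.⊥
  ... | yes e∈⊥ = ⊥-elim (SubsetP.∉⊥ e∈⊥)
  ... | no _ = refl

module _ {a} (w : Fin a → ℚ) (w≥0 : ∀ e → 0ℚ ≤ w e) where

  weight-∪ : ∀ S T → weight w (S ∪ T) ≤ weight w S + weight w T
  weight-∪ S T = ℚP.≤-trans (sum-mono pointwise) (ℚP.≤-reflexive (∑-distrib-+ (λ e → [ does (e ∈? S) ]· w e) (λ e → [ does (e ∈? T) ]· w e)))
    where
    pointwise : ∀ e → [ does (e ∈? (S ∪ T)) ]· w e ≤ [ does (e ∈? S) ]· w e + [ does (e ∈? T) ]· w e
    pointwise e with e ∈? (S ∪ T) | e ∈? S | e ∈? T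
    ... | no _    | dS    | dT    = ℚP.+-mono-≤ ([]·-nonneg (does dS) (w≥0 e)) ([]·-nonneg (does dT) (w≥0 e))
    ... | yes _   | yes _ | dT    = ≤-+-nonneg (w e) ([]·-nonneg (does dT) (w≥0 e))
    ... | yes _   | no _  | yes _ = ℚP.≤-reflexive (sym (ℚP.+-identityˡ (w e)))
    ... | yes e∈∪ | no e∉S | no e∉T with SubsetP.x∈p∪q⁻ S T e∈∪
    ...   | inj₁ e∈S = ⊥-elim (e∉S e∈S)
    ...   | inj₂ e∈T = ⊥-elim (e∉T e∈T)

  weight-⁅⁆ : ∀ e → weight w ⁅ e ⁆ ≤ w e
  weight-⁅⁆ e = ℚP.≤-trans (sum-mono pointwise) (ℚP.≤-reflexive (sum-point e (w e)))
    where
    pointwise : ∀ e' → [ does (e' ∈? ⁅ e ⁆) ]· w e' ≤ [ does (e' Fin.≟ e) ]· w e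
    pointwise e' with e' ∈? ⁅ e ⁆ | e' Fin.≟ e
    ... | yes _ | yes refl = ℚP.≤-refl
    ... | yes e'∈ | no e'≢e = ⊥-elim (e'≢e (SubsetP.x∈⁅y⁆⇒x≡y e e'∈))
    ... | no _ | d = []·-nonneg (does d) (w≥0 e)

  weight-list : ∀ (es : List (Fin a)) → weight w (⋃ (map ⁅_⁆ es)) ≤ foldr _+_ 0ℚ (map w es)
  weight-list [] = ℚP.≤-reflexive (weight-⊥ w)
  weight-list (e ∷ es) = ℚP.≤-trans (weight-∪ ⁅ e ⁆ (⋃ (map ⁅_⁆ es)))
                                    (ℚP.+-mono-≤ (weight-⁅⁆ e) (weight-list es))

  weight-⋃ : ∀ {b} (E : Fin b → Subset a) → weight w (⋃ (map E (allFin b))) ≤ sum (λ v → weight w (E v))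
  weight-⋃ E rewrite map-tabulate id E = go E
    where
    go : ∀ {b} (E : Fin b → Subset a) → weight w (⋃ (tabulate E)) ≤ sum (λ v → weight w (E v))
    go {ℕ.zero} E = ℚP.≤-reflexive (weight-⊥ w)
    go {ℕ.suc b} E = ℚP.≤-trans (weight-∪ (E zero) (⋃ (tabulate (E ∘ suc))))
                                (ℚP.+-monoʳ-≤ (weight w (E zero)) (go (E ∘ suc)))

⋃⁺ : ∀ {a b} (E : Fin b → Subset a) {js j e} → j ∈ˡ js → e ∈ E j → e ∈ ⋃ (map E js)
⋃⁺ E {j ∷ js} (here refl) e∈Ej = SubsetP.p⊆p∪q (⋃ (map E js)) e∈Ej
⋃⁺ E {j ∷ js} (there j∈js) e∈Ej = SubsetP.q⊆p∪q (E j) (⋃ (map E js)) (⋃⁺ E j∈js e∈Ej)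

⋃⁻ : ∀ {a b} (E : Fin b → Subset a) js {e} → e ∈ ⋃ (map E js) → ∃[ j ] (j ∈ˡ js × e ∈ E j)
⋃⁻ E [] e∈ = ⊥-elim (SubsetP.∉⊥ e∈)
⋃⁻ E (j ∷ js) e∈ with SubsetP.x∈p∪q⁻ (E j) (⋃ (map E js)) e∈
... | inj₁ e∈Ej = j , here refl , e∈Ej
... | inj₂ e∈rest with ⋃⁻ E js e∈rest
...   | j' , j'∈js , e∈Ej' = j' , there j'∈js , e∈Ej'

least : ∀ {N} (P : Fin N → Set) → (∀ x → Dec (P x)) → ∀ x → P x →
        ∃[ w ] (P w × (∀ w' → P w' → toℕ w ℕ.≤ toℕ w'))
least P P? zero P0 = zero , P0 , λ _ _ → ℕ.z≤n
least P P? (suc x) Px with P? zero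
... | yes P0 = zero , P0 , λ _ _ → ℕ.z≤n
... | no ¬P0 with least (P ∘ suc) (P? ∘ suc) x Px
...   | w , Pw , minimal = suc w , Pw , λ { zero P0 → ⊥-elim (¬P0 P0) ; (suc w') Pw' → ℕ.s≤s (minimal w' Pw') }

if-yes : ∀ {P : Set} (d : Dec P) → P → ∀ {A : Set} {x y : A} → (if does d then x else y) ≡ x
if-yes (yes _) _ = refl
if-yes (no ¬p) p = ⊥-elim (¬p p)

if-no : ∀ {P : Set} (d : Dec P) → ¬ P → ∀ {A : Set} {x y : A} → (if does d then x else y) ≡ y
if-no (yes p) ¬p = ⊥-elim (¬p p)
if-no (no _) _ = refl

¬¬-∀Fin : ∀ {N} {P : Fin N → Set} → (∀ x → ¬ ¬ P x) → ¬ ¬ (∀ x → P x)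
¬¬-∀Fin {ℕ.zero} _ k = k (λ ())
¬¬-∀Fin {ℕ.suc N} {P} ¬¬P k =
  ¬¬P zero (λ P0 → ¬¬-∀Fin (¬¬P ∘ suc) (λ Ps → k (λ { zero → P0 ; (suc x) → Ps x })))

¬¬-× : ∀ {A B : Set} → ¬ ¬ A → ¬ ¬ B → ¬ ¬ (A × B)
¬¬-× ¬¬A ¬¬B k = ¬¬A (λ a → ¬¬B (λ b → k (a , b)))

module Graph (I : Instance) where
  open Instance I

  reach-refl : ∀ {G v} → Reach I G v v
  reach-refl = [] , []

  reach-trans : ∀ {G u v w} → Reach I G u v → Reach I G v w → Reach I G u w
  reach-trans ([] , []) r = r
  reach-trans ((e ∷⟨ j ⟩ p) , (e∈G ∷ p⊆G)) r with reach-trans (p , p⊆G) r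
  ... | q , q⊆G = (e ∷⟨ j ⟩ q) , (e∈G ∷ q⊆G)

  reach-sym : ∀ {G v w} → Reach I G v w → Reach I G w v
  reach-sym ([] , []) = [] , []
  reach-sym ((e ∷⟨ j ⟩ p) , (e∈G ∷ p⊆G)) =
    reach-trans (reach-sym (p , p⊆G)) ((e ∷⟨ flip-joins j ⟩ []) , (e∈G ∷ []))
    where
    flip-joins : ∀ {e v w} → Joins I e v w → Joins I e w v
    flip-joins (inj₁ e=vw) = inj₂ e=vw
    flip-joins (inj₂ e=wv) = inj₁ e=wv

  reach-mono : ∀ {G G' v w} → G ⊆ G' → Reach I G v w → Reach I G' v w
  reach-mono G⊆G' (p , p⊆G) = p , All.map G⊆G' p⊆G

  path-reach : ∀ {G v w} (p : Path I v w) → edgeSet I p ⊆ G → Reach I G v w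
  path-reach p p⊆G = proj₁ p , All.map p⊆G (listed (edgesW I (proj₁ p)))
    where
    listed : ∀ (es : List (Fin m)) → All (_∈ ⋃ (map ⁅_⁆ es)) es
    listed [] = []
    listed (e ∷ es) = SubsetP.p⊆p∪q (⋃ (map ⁅_⁆ es)) (SubsetP.x∈⁅x⁆ e)
                      ∷ All.map (SubsetP.q⊆p∪q ⁅ e ⁆ (⋃ (map ⁅_⁆ es))) (listed es)

  weight-path : ∀ (w : Fin m → ℚ) → (∀ e → 0ℚ ≤ w e) → ∀ {v v'} (p : Path I v v') → weight w (edgeSet I p) ≤ pcost I w p
  weight-path w w≥0 p = weight-list w w≥0 (edgesW I (proj₁ p))

  -- Reachability in (V, G) is decidable.  This holds classically; the main
  -- argument assumes such deciders and discharges them by double negation.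
  ReachDecider : Subset m → Set
  ReachDecider G = ∀ v w → Dec (Reach I G v w)

  ¬¬-decider : ∀ G → ¬ ¬ ReachDecider G
  ¬¬-decider G = ¬¬-∀Fin (λ v → ¬¬-∀Fin (λ w → ¬¬-excluded-middle))

  module Representatives (G : Subset m) (D : ReachDecider G) where

    leastReaching : ∀ v → ∃[ w ] (Reach I G w v × (∀ w' → Reach I G w' v → toℕ w ℕ.≤ toℕ w'))
    leastReaching v = least (λ w → Reach I G w v) (λ w → D w v) v reach-refl

    rep : Fin n → Fin n
    rep v = proj₁ (leastReaching v)

    rep-unique : ∀ {v w} → IsRep I G v → Reach I G v w → rep w ≡ v
    rep-unique {v} {w} v-rep v~w = FinP.toℕ-injective (ℕP.≤-antisym
      (proj₂ (proj₂ (leastReaching w)) v v~w)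
      (v-rep (rep w) (reach-trans v~w (reach-sym (proj₁ (proj₂ (leastReaching w)))))))

-- For a subgraph (V, G)
-- in which the first b pairs are connected, the potential Φ b is the sum,
-- over the components containing one of these pairs, of the largest weight
-- of such a pair.  It is realised as the sum of f over "leaders", one
-- distinguished pair per component.
module Potential (I : Instance) (f : Fin (Instance.k I) → ℚ) (f≥0 : ∀ j → 0ℚ ≤ f j) where
  open Instance I
  open Graph I

  -- j ≼ j': pair j' dominates pair j (larger weight, ties go to the smaller
  -- index).  This is a decidable total order on pairs.
  _≼_ : Fin k → Fin k → Set
  j ≼ j' = f j < f j' ⊎ (f j ≡ f j' × toℕ j' ℕ.≤ toℕ j)

  _≼?_ : ∀ j j' → Dec (j ≼ j')
  j ≼? j' = (f j ℚP.<? f j') ⊎-dec ((f j ℚP.≟ f j') ×-dec (toℕ j' ℕP.≤? toℕ j))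

  ≼-refl : ∀ j → j ≼ j
  ≼-refl j = inj₂ (refl , ℕP.≤-refl)

  ≼-trans : ∀ {j j' j''} → j ≼ j' → j' ≼ j'' → j ≼ j''
  ≼-trans (inj₁ lt₁) (inj₁ lt₂) = inj₁ (ℚP.<-trans lt₁ lt₂)
  ≼-trans {j} (inj₁ lt₁) (inj₂ (eq₂ , _)) = inj₁ (subst (f j <_) eq₂ lt₁)
  ≼-trans {j'' = j''} (inj₂ (eq₁ , _)) (inj₁ lt₂) = inj₁ (subst (_< f j'') (sym eq₁) lt₂)
  ≼-trans (inj₂ (eq₁ , le₁)) (inj₂ (eq₂ , le₂)) = inj₂ (trans eq₁ eq₂ , ℕP.≤-trans le₂ le₁)

  ≼-total : ∀ j j' → j ≼ j' ⊎ j' ≼ j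
  ≼-total j j' with ℚP.<-cmp (f j) (f j')
  ... | tri< lt _ _ = inj₁ (inj₁ lt)
  ... | tri> _ _ gt = inj₂ (inj₁ gt)
  ... | tri≈ _ eq _ with ℕP.≤-total (toℕ j) (toℕ j')
  ...   | inj₁ le = inj₂ (inj₂ (sym eq , le))
  ...   | inj₂ ge = inj₁ (inj₂ (eq , ge))

  ≼-antisym : ∀ {j j'} → j ≼ j' → j' ≼ j → j ≡ j'
  ≼-antisym (inj₁ lt) (inj₁ gt) = ⊥-elim (ℚP.<-asym lt gt)
  ≼-antisym (inj₁ lt) (inj₂ (eq , _)) = ⊥-elim (ℚP.<-irrefl (sym eq) lt)
  ≼-antisym (inj₂ (eq , _)) (inj₁ gt) = ⊥-elim (ℚP.<-irrefl (sym eq) gt)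
  ≼-antisym (inj₂ (_ , ge)) (inj₂ (_ , le)) = FinP.toℕ-injective (ℕP.≤-antisym le ge)

  ≼⇒≤ : ∀ {j j'} → j ≼ j' → f j ≤ f j'
  ≼⇒≤ (inj₁ lt) = ℚP.<⇒≤ lt
  ≼⇒≤ (inj₂ (eq , _)) = ℚP.≤-reflexive eq

  greatest : ∀ (js : List (Fin k)) j0 →
    ∃[ g ] (j0 ≼ g × All (_≼ g) js × (g ≡ j0 ⊎ g ∈ˡ js))
  greatest [] j0 = j0 , ≼-refl j0 , [] , inj₁ refl
  greatest (j ∷ js) j0 with greatest js j0
  ... | g , j0≼g , js≼g , g∈ with ≼-total j g
  ...   | inj₁ j≼g = g , j0≼g , j≼g ∷ js≼g , map₂ there g∈
  ...   | inj₂ g≼j = j , ≼-trans j0≼g g≼j , ≼-refl j ∷ All.map (λ j'≼g → ≼-trans j'≼g g≼j) js≼g , inj₂ (here refl)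

  -- The admissible cost q of connecting x, in iteration i, to the component
  -- of (V, G) with representative v: either q ≤ 0, or that component avoids x,
  -- is joined to x in (V, G'), and q is at most both f i and the weight f j0
  -- of some pair j0 < b inside the component.
  Charge : Subset m → Subset m → ℕ → Fin k → Fin n → ℚ → Fin n → Set
  Charge G G' b i x q v = q ≤ 0ℚ ⊎ (IsRep I G v × Reach I G' x v × ¬ Reach I G v x × q ≤ f i ×
                               ∃[ j0 ] (toℕ j0 ℕ.< b × Reach I G v (s j0) × q ≤ f j0))

  module Leaders (G : Subset m) (D : ReachDecider G) where

    Connected : ℕ → Set
    Connected b = ∀ j → toℕ j ℕ.< b → Reach I G (s j) (t j)

    Leader : ℕ → Fin k → Set
    Leader b j = toℕ j ℕ.< b × Reach I G (s j) (t j) ×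
      (∀ j' → toℕ j' ℕ.< b → Reach I G (s j') (t j') → Reach I G (s j) (s j') → j' ≼ j)

    opaque
      leader? : ∀ b j → Dec (Leader b j)
      leader? b j = (toℕ j ℕ.<? b) ×-dec D (s j) (t j) ×-dec
        FinP.all? (λ j' → (toℕ j' ℕ.<? b) →-dec (D (s j') (t j') →-dec (D (s j) (s j') →-dec (j' ≼? j))))

    Φ : ℕ → ℚ
    Φ b = sum (λ j → [ does (leader? b j) ]· f j)

    Φ-nonneg : ∀ b → 0ℚ ≤ Φ b
    Φ-nonneg b = sum-nonneg (λ j → []·-nonneg (does (leader? b j)) (f≥0 j))

    leader-unique : ∀ {b j j'} → Leader b j → Leader b j' → Reach I G (s j) (s j') → j ≡ j'
    leader-unique (j<b , j-conn , j-dom) (j'<b , j'-conn , j'-dom) sj~sj' =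
      ≼-antisym (j'-dom _ j<b j-conn (reach-sym sj~sj')) (j-dom _ j'<b j'-conn sj~sj')

    LeaderOf : ℕ → Fin k → Fin k → Set
    LeaderOf b j0 L = Leader b L × Reach I G (s L) (s j0) × f j0 ≤ f L

    leader-exists : ∀ {b} j0 → toℕ j0 ℕ.< b → Connected b → ∃[ L ] LeaderOf b j0 L
    leader-exists {b} j0 j0<b conn =
      L , (proj₁ L-near , conn L (proj₁ L-near) , dominates) , reach-sym (proj₂ L-near) , ≼⇒≤ j0≼L
      where
      Near : Fin k → Set
      Near j = toℕ j ℕ.< b × Reach I G (s j0) (s j)
      near? : ∀ j → Dec (Near j)
      near? j = (toℕ j ℕ.<? b) ×-dec D (s j0) (s j)
      candidates : List (Fin k)
      candidates = filter near? (allFin k)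
      top : ∃[ g ] (j0 ≼ g × All (_≼ g) candidates × (g ≡ j0 ⊎ g ∈ˡ candidates))
      top = greatest candidates j0
      L : Fin k
      L = proj₁ top
      j0≼L : j0 ≼ L
      j0≼L = proj₁ (proj₂ top)
      near-of : ∀ {g} → g ≡ j0 ⊎ g ∈ˡ candidates → Near g
      near-of (inj₁ refl) = j0<b , reach-refl
      near-of (inj₂ g∈) = proj₂ (∈-filter⁻ near? {xs = allFin k} g∈)
      L-near : Near L
      L-near = near-of (proj₂ (proj₂ (proj₂ top)))
      dominates : ∀ j' → toℕ j' ℕ.< b → Reach I G (s j') (t j') → Reach I G (s L) (s j') → j' ≼ L
      dominates j' j'<b _ sL~sj' = All.lookup (proj₁ (proj₂ (proj₂ top)))
        (∈-filter⁺ near? {xs = allFin k} (∈-allFin j') (j'<b , reach-trans (proj₂ L-near) sL~sj'))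

    Φ-zero : Φ 0 ≡ 0ℚ
    Φ-zero = trans (sum-cong-≗ no-leader) (sum-replicate-zero k)
      where
      no-leader : ∀ j → [ does (leader? 0 j) ]· f j ≡ 0ℚ
      no-leader j with leader? 0 j
      ... | yes (() , _)
      ... | no _ = refl

    Φ-suc : ∀ i → Φ (ℕ.suc (toℕ i)) ≤ Φ (toℕ i) + f i
    Φ-suc i = ℚP.≤-trans (sum-mono pointwise) (ℚP.≤-reflexive (begin
      sum (λ j → [ does (leader? (toℕ i) j) ]· f j + [ does (j Fin.≟ i) ]· f i)
        ≡⟨ ∑-distrib-+ (λ j → [ does (leader? (toℕ i) j) ]· f j) (λ j → [ does (j Fin.≟ i) ]· f i) ⟩
      Φ (toℕ i) + sum (λ j → [ does (j Fin.≟ i) ]· f i)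
        ≡⟨ cong (_+_ (Φ (toℕ i))) (sum-point i (f i)) ⟩
      Φ (toℕ i) + f i ∎))
      where
      open ≡-Reasoning
      shrink : ∀ {j} → Leader (ℕ.suc (toℕ i)) j → j ≢ i → Leader (toℕ i) j
      shrink (j≤i , conn , dom) j≢i =
        ℕP.≤∧≢⇒< (ℕP.≤-pred j≤i) (j≢i ∘ FinP.toℕ-injective) , conn , λ j' j'<i → dom j' (ℕP.m<n⇒m<1+n j'<i)
      pointwise : ∀ j → [ does (leader? (ℕ.suc (toℕ i)) j) ]· f j
                      ≤ [ does (leader? (toℕ i) j) ]· f j + [ does (j Fin.≟ i) ]· f i
      pointwise j with leader? (ℕ.suc (toℕ i)) j | leader? (toℕ i) j | j Fin.≟ i
      ... | no _ | d | d' = ℚP.≤-trans (ℚP.≤-reflexive (sym (ℚP.+-identityʳ 0ℚ)))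
                              (ℚP.+-mono-≤ ([]·-nonneg (does d) (f≥0 j)) ([]·-nonneg (does d') (f≥0 i)))
      ... | yes _ | yes _ | d' = ≤-+-nonneg (f j) ([]·-nonneg (does d') (f≥0 i))
      ... | yes _ | no _ | yes refl = ℚP.≤-reflexive (sym (ℚP.+-identityˡ (f j)))
      ... | yes lead | no ¬lead | no j≢i = ⊥-elim (¬lead (shrink lead j≢i))

  module Growth (G G' : Subset m) (D : ReachDecider G) (D' : ReachDecider G') (G⊆G' : G ⊆ G') where
    open Leaders G D
    module New = Leaders G' D'

    connected-grows : ∀ {b} → Connected b → New.Connected b
    connected-grows conn j j<b = reach-mono G⊆G' (conn j j<b)

    leader-persists : ∀ {b j} → Connected b → New.Leader b j → Leader b j
    leader-persists conn (j<b , _ , dom) =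
      j<b , conn _ j<b , λ j' j'<b conn' sj~sj' → dom j' j'<b (reach-mono G⊆G' conn') (reach-mono G⊆G' sj~sj')

    Φ-antitone : ∀ {b} → Connected b → New.Φ b ≤ Φ b
    Φ-antitone {b} conn = sum-mono pointwise
      where
      pointwise : ∀ j → [ does (New.leader? b j) ]· f j ≤ [ does (leader? b j) ]· f j
      pointwise j with New.leader? b j | leader? b j
      ... | no _ | d = []·-nonneg (does d) (f≥0 j)
      ... | yes _ | yes _ = ℚP.≤-refl
      ... | yes lead | no ¬lead = ⊥-elim (¬lead (leader-persists conn lead))

    -- Each leader that is lost is charged to one component: the leader of
    -- the component of x to the component whose leader survives, any other
    -- lost leader to its own component.
    module Merge {b i x} (conn : Connected b) (i<b : toℕ i ℕ.< b) (x~si : Reach I G x (s i)) where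
      open Representatives G D

      Lost : Fin k → Set
      Lost j = Leader b j × ¬ New.Leader b j

      lost? : ∀ j → Dec (Lost j)
      lost? j = leader? b j ×-dec ¬? (New.leader? b j)

      lostWeight : Fin k → ℚ
      lostWeight j = [ does (lost? j) ]· f j

      Φ-split : Φ b ≡ New.Φ b + sum lostWeight
      Φ-split = trans (sum-cong-≗ pointwise) (∑-distrib-+ (λ j → [ does (New.leader? b j) ]· f j) lostWeight)
        where
        pointwise : ∀ j → [ does (leader? b j) ]· f j ≡ [ does (New.leader? b j) ]· f j + lostWeight j
        pointwise j with leader? b j | New.leader? b j
        ... | yes _ | yes _ = sym (ℚP.+-identityʳ (f j))
        ... | yes _ | no _ = sym (ℚP.+-identityˡ (f j))
        ... | no _ | no _ = sym (ℚP.+-identityʳ 0ℚ)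
        ... | no ¬lead | yes lead = ⊥-elim (¬lead (leader-persists conn lead))

      old : ∃[ L ] LeaderOf b i L
      old = leader-exists i i<b conn
      jx : Fin k
      jx = proj₁ old
      jx-leader : Leader b jx
      jx-leader = proj₁ (proj₂ old)
      sjx~si : Reach I G (s jx) (s i)
      sjx~si = proj₁ (proj₂ (proj₂ old))
      fi≤fjx : f i ≤ f jx
      fi≤fjx = proj₂ (proj₂ (proj₂ old))

      new : ∃[ L ] New.LeaderOf b i L
      new = New.leader-exists i i<b (connected-grows conn)
      L' : Fin k
      L' = proj₁ new

      target : Fin k → Fin n
      target j = if does (j Fin.≟ jx) then rep (s L') else rep (s j)

      chargedTerm : Fin n → Fin k → ℚ
      chargedTerm v j = [ does (v Fin.≟ target j) ]· lostWeight j

      chargedTerm-nonneg : ∀ v j → 0ℚ ≤ chargedTerm v j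
      chargedTerm-nonneg v j = []·-nonneg (does (v Fin.≟ target j)) ([]·-nonneg (does (lost? j)) (f≥0 j))

      charged : Fin n → ℚ
      charged v = sum (chargedTerm v)

      lost-charged : sum lostWeight ≡ sum charged
      lost-charged = trans (sum-cong-≗ (λ j → sym (sum-point (target j) (lostWeight j))))
                           (∑-comm (λ j v → chargedTerm v j))

      charged-≥ : ∀ {j v} → v ≡ target j → Lost j → f j ≤ charged v
      charged-≥ {j} {v} v≡tj lost =
        ℚP.≤-trans own-term (term≤sum (chargedTerm-nonneg v) j)
        where
        own-term : f j ≤ chargedTerm v j
        own-term = ℚP.≤-reflexive (sym (trans (if-yes (v Fin.≟ target j) v≡tj) (if-yes (lost? j) lost)))

      -- If its old leader Lv is lost it pays with Lv;
      -- otherwise Lv is the new leader L', so jx is lost and charged to it.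
      charge-avoiding : ∀ {q v j0} → IsRep I G v → Reach I G' x v → ¬ Reach I G v x →
        q ≤ f i → toℕ j0 ℕ.< b → Reach I G v (s j0) → q ≤ f j0 → q ≤ charged v
      charge-avoiding {q} {v} {j0} v-rep x~'v v≁x q≤fi j0<b v~sj0 q≤fj0 = by-survival (New.leader? b Lv)
        where
        own : ∃[ L ] LeaderOf b j0 L
        own = leader-exists j0 j0<b conn
        Lv : Fin k
        Lv = proj₁ own
        Lv-leader : Leader b Lv
        Lv-leader = proj₁ (proj₂ own)
        v~sLv : Reach I G v (s Lv)
        v~sLv = reach-trans v~sj0 (reach-sym (proj₁ (proj₂ (proj₂ own))))
        q≤fLv : q ≤ f Lv
        q≤fLv = ℚP.≤-trans q≤fj0 (proj₂ (proj₂ (proj₂ own)))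
        Lv≢jx : Lv ≢ jx
        Lv≢jx Lv≡jx = v≁x (reach-trans (subst (λ j → Reach I G v (s j)) Lv≡jx v~sLv)
                                       (reach-trans sjx~si (reach-sym x~si)))
        rep-sLv : rep (s Lv) ≡ v
        rep-sLv = rep-unique v-rep v~sLv
        by-survival : Dec (New.Leader b Lv) → q ≤ charged v
        by-survival (no Lv-lost) =
          ℚP.≤-trans q≤fLv (charged-≥ (sym (trans (if-no (Lv Fin.≟ jx) Lv≢jx) rep-sLv)) (Lv-leader , Lv-lost))
        by-survival (yes Lv-survives) =
          ℚP.≤-trans q≤fi (ℚP.≤-trans fi≤fjx (charged-≥ v≡target-jx (jx-leader , jx-lost)))
          where
          sL'~si : Reach I G' (s L') (s i)
          sL'~si = proj₁ (proj₂ (proj₂ new))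
          Lv≡L' : Lv ≡ L'
          Lv≡L' = New.leader-unique Lv-survives (proj₁ (proj₂ new))
            (reach-trans (reach-mono G⊆G' (reach-sym v~sLv))
              (reach-trans (reach-sym x~'v) (reach-trans (reach-mono G⊆G' x~si) (reach-sym sL'~si))))
          jx-lost : ¬ New.Leader b jx
          jx-lost jx-survives = Lv≢jx (trans Lv≡L' (sym (New.leader-unique jx-survives (proj₁ (proj₂ new))
            (reach-trans (reach-mono G⊆G' sjx~si) (reach-sym sL'~si)))))
          v≡target-jx : v ≡ target jx
          v≡target-jx = sym (trans (if-yes (jx Fin.≟ jx) refl) (trans (cong (rep ∘ s) (sym Lv≡L')) rep-sLv))

      charge-≤ : ∀ {q v} → Charge G G' b i x q v → q ≤ charged v
      charge-≤ {v = v} (inj₁ q≤0) = ℚP.≤-trans q≤0 (sum-nonneg (chargedTerm-nonneg v))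
      charge-≤ (inj₂ (v-rep , x~'v , v≁x , q≤fi , j0 , j0<b , v~sj0 , q≤fj0)) =
        charge-avoiding v-rep x~'v v≁x q≤fi j0<b v~sj0 q≤fj0

      merge : (cost : Fin n → ℚ) → (∀ v → Charge G G' b i x (cost v) v) → New.Φ b + sum cost ≤ Φ b
      merge cost admissible = begin
        New.Φ b + sum cost        ≤⟨ ℚP.+-monoʳ-≤ (New.Φ b) (sum-mono (λ v → charge-≤ (admissible v))) ⟩
        New.Φ b + sum charged     ≡⟨ cong (_+_ (New.Φ b)) (sym lost-charged) ⟩
        New.Φ b + sum lostWeight  ≡⟨ sym Φ-split ⟩
        Φ b                       ∎
        where open ℚP.≤-Reasoning

telescope : ∀ {K} (C before after g : Fin K → ℚ) (p : ℚ) → 0ℚ ≤ p → (∀ i → 0ℚ ≤ after i) →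
  (∀ i → C i + after i ≤ before i) →
  (∀ i i' → toℕ i' ≡ ℕ.suc (toℕ i) → before i' ≤ after i + g i') →
  (∀ i → toℕ i ≡ 0 → before i ≤ p + g i) →
  sum C ≤ p + sum g
telescope {ℕ.zero} _ _ _ _ p p≥0 _ _ _ _ = ℚP.≤-trans p≥0 (ℚP.≤-reflexive (sym (ℚP.+-identityʳ p)))
telescope {ℕ.suc K} C before after g p p≥0 after≥0 spend rise initial = begin
  C zero + sum (C ∘ suc)                   ≤⟨ ℚP.+-monoʳ-≤ (C zero) rest ⟩
  C zero + (after zero + sum (g ∘ suc))    ≡⟨ sym (ℚP.+-assoc (C zero) (after zero) (sum (g ∘ suc))) ⟩
  (C zero + after zero) + sum (g ∘ suc)    ≤⟨ ℚP.+-monoˡ-≤ (sum (g ∘ suc)) (ℚP.≤-trans (spend zero) (initial zero refl)) ⟩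
  (p + g zero) + sum (g ∘ suc)             ≡⟨ ℚP.+-assoc p (g zero) (sum (g ∘ suc)) ⟩
  p + sum g                                ∎
  where
  open ℚP.≤-Reasoning
  rest : sum (C ∘ suc) ≤ after zero + sum (g ∘ suc)
  rest = telescope (C ∘ suc) (before ∘ suc) (after ∘ suc) (g ∘ suc) (after zero) (after≥0 zero) (after≥0 ∘ suc)
    (spend ∘ suc) (λ i i' i'≡1+i → rise (suc i) (suc i') (cong ℕ.suc i'≡1+i)) (λ i i≡0 → rise zero (suc i) (cong ℕ.suc i≡0))

module Execution (I : Instance) (r : Run I) where
  open Instance I
  open Run r
  open Graph I

  F : Fin k → Subset m
  F i = Fbefore I A i

  wt : Fin k → Fin m → ℚ
  wt i = ci I (F i) i

  P : ∀ i → Path I (s i) (t i)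
  P i = proj₁ (step i)

  ℓ-is-cost : ∀ i → ℓ i ≡ pcost I (wt i) (P i)
  ℓ-is-cost i = proj₁ (proj₂ (proj₂ (step i)))

  class-floor : ∀ i → FloorLog2 (ℓ i) (cls i)
  class-floor i = proj₁ (proj₂ (proj₂ (proj₂ (step i))))

  Bs : Fin k → Subset m
  Bs i = proj₁ (proj₂ (proj₂ (proj₂ (proj₂ (step i)))))

  Bt : Fin k → Subset m
  Bt i = proj₁ (proj₂ (proj₂ (proj₂ (proj₂ (proj₂ (proj₂ (step i)))))))

  G₁ G₂ G₃ : Fin k → Subset m
  G₁ i = F i ∪ edgeSet I (P i)
  G₂ i = F i ∪ edgeSet I (P i) ∪ Bs i
  G₃ i = G₂ i ∪ Bt i

  s-step : ∀ i → CompStep I (G₁ i) (wt i) cls i (s i) (Bs i)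
  s-step i = proj₁ (proj₂ (proj₂ (proj₂ (proj₂ (proj₂ (step i))))))

  t-step : ∀ i → CompStep I (G₂ i) (wt i) cls i (t i) (Bt i)
  t-step i = proj₁ (proj₂ (proj₂ (proj₂ (proj₂ (proj₂ (proj₂ (proj₂ (step i))))))))

  X : Fin k → Subset m
  X i = edgeSet I (P i) ∪ Bs i ∪ Bt i

  A-is-new : ∀ i → A i ≡ X i ∩ ∁ (F i)
  A-is-new i = proj₂ (proj₂ (proj₂ (proj₂ (proj₂ (proj₂ (proj₂ (proj₂ (step i))))))))

  Es Et : Fin k → Fin n → Subset m
  Es i = proj₁ (s-step i)
  Et i = proj₁ (t-step i)

  wt-nonneg : ∀ i e → 0ℚ ≤ wt i e
  wt-nonneg i e with e ∈? F i
  ... | yes _ = ℚP.≤-refl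
  ... | no _ = ℚP.≤-trans (c≥0 e) (≤-+-nonneg (c e) (*-nonneg (frac-nonneg (R i) (u e) {{ℕ.>-nonZero (u>0 e)}}) (c≥0 e)))

  Fbefore⁺ : ∀ {i j e} → toℕ j ℕ.< toℕ i → e ∈ A j → e ∈ F i
  Fbefore⁺ {i} {j} j<i e∈Aj =
    ⋃⁺ A (∈-filter⁺ (λ j' → toℕ j' ℕ.<? toℕ i) {xs = allFin k} (∈-allFin j) j<i) e∈Aj

  Fbefore⁻ : ∀ {i e} → e ∈ F i → ∃[ j ] (toℕ j ℕ.< toℕ i × e ∈ A j)
  Fbefore⁻ {i} e∈F with ⋃⁻ A (filter (λ j' → toℕ j' ℕ.<? toℕ i) (allFin k)) e∈F
  ... | j , j∈ , e∈Aj = j , proj₂ (∈-filter⁻ (λ j' → toℕ j' ℕ.<? toℕ i) {xs = allFin k} j∈) , e∈Aj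

  bought-later : ∀ {i i'} → toℕ i ℕ.< toℕ i' → ∀ {e} → e ∈ F i ⊎ e ∈ X i → e ∈ F i'
  bought-later {i} i<i' {e} e∈ with e ∈? F i
  ... | yes e∈F with Fbefore⁻ e∈F
  ...   | j , j<i , e∈Aj = Fbefore⁺ (ℕP.<-trans j<i i<i') e∈Aj
  bought-later i<i' (inj₁ e∈F) | no e∉F = ⊥-elim (e∉F e∈F)
  bought-later {i} i<i' (inj₂ e∈X) | no e∉F =
    Fbefore⁺ i<i' (subst (_ ∈_) (sym (A-is-new i)) (SubsetP.x∈p∩q⁺ (e∈X , SubsetP.x∉p⇒x∈∁p e∉F)))

  G₁⊆G₂ : ∀ i → G₁ i ⊆ G₂ i
  G₁⊆G₂ i = SubsetP.⊆-trans (SubsetP.p⊆p∪q (Bs i))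
              (SubsetP.⊆-reflexive (SubsetP.∪-assoc (F i) (edgeSet I (P i)) (Bs i)))

  G₂⊆G₃ : ∀ i → G₂ i ⊆ G₃ i
  G₂⊆G₃ i = SubsetP.p⊆p∪q (Bt i)

  G₃≡F∪X : ∀ i → G₃ i ≡ F i ∪ X i
  G₃≡F∪X i = trans (SubsetP.∪-assoc (F i) (edgeSet I (P i) ∪ Bs i) (Bt i))
                   (cong (F i ∪_) (SubsetP.∪-assoc (edgeSet I (P i)) (Bs i) (Bt i)))

  G₃⊆G₁-next : ∀ i i' → toℕ i' ≡ ℕ.suc (toℕ i) → G₃ i ⊆ G₁ i'
  G₃⊆G₁-next i i' i'≡1+i e∈G₃ = SubsetP.p⊆p∪q (edgeSet I (P i'))
    (bought-later (ℕP.≤-reflexive (sym i'≡1+i)) (SubsetP.x∈p∪q⁻ (F i) (X i) (subst (_ ∈_) (G₃≡F∪X i) e∈G₃)))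

  pairs-connected : ∀ i j → toℕ j ℕ.< ℕ.suc (toℕ i) → Reach I (G₁ i) (s j) (t j)
  pairs-connected i j j≤i with toℕ j ℕ.≟ toℕ i
  ... | yes j≡i with FinP.toℕ-injective j≡i
  ...   | refl = path-reach (P i) (SubsetP.q⊆p∪q (F i) (edgeSet I (P i)))
  pairs-connected i j j≤i | no j≢i = path-reach (P j) (λ e∈Pj → SubsetP.p⊆p∪q (edgeSet I (P i))
    (bought-later (ℕP.≤∧≢⇒< (ℕP.≤-pred j≤i) j≢i) (inj₂ (SubsetP.p⊆p∪q (Bs j ∪ Bt j) e∈Pj))))

  iterationCost : Fin k → ℚ
  iterationCost i = sum (λ e → [ does (e ∈? A i) ]· (((+ copies I i e) / 1) * c e))

  S T : Fin k → ℚ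
  S i = sum (λ v → weight (wt i) (Es i v))
  T i = sum (λ v → weight (wt i) (Et i v))

  totalCost-is-sum : totalCost I r ≡ sum iterationCost
  totalCost-is-sum = trans (Σℚ≡sum (λ i → Σℚ (bought i))) (sum-cong-≗ (λ i → Σℚ≡sum (bought i)))
    where
    bought : Fin k → Fin m → ℚ
    bought i e = [ does (e ∈? A i) ]· (((+ copies I i e) / 1) * c e)

  copies-≤-modified : ∀ i e → [ does (e ∈? A i) ]· (((+ copies I i e) / 1) * c e) ≤ [ does (e ∈? X i) ]· wt i e
  copies-≤-modified i e with e ∈? A i
  ... | no _ = []·-nonneg (does (e ∈? X i)) (wt-nonneg i e)
  ... | yes e∈A with SubsetP.x∈p∩q⁻ (X i) (∁ (F i)) (subst (e ∈_) (A-is-new i) e∈A)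
  ...   | e∈X , e∈∁F = ℚP.≤-trans (ceil-cost-≤ (R i) (u e) {{ℕ.>-nonZero (u>0 e)}} (c e) (c≥0 e))
    (ℚP.≤-reflexive (sym (trans (if-yes (e ∈? X i) e∈X) (if-no (e ∈? F i) (SubsetP.x∈∁p⇒x∉p e∈∁F)))))

  iteration-cost : ∀ i → iterationCost i ≤ ℓ i + (S i + T i)
  iteration-cost i = begin
    iterationCost i                                        ≤⟨ sum-mono (copies-≤-modified i) ⟩
    weight w (X i)                                         ≤⟨ weight-∪ w w≥0 (edgeSet I (P i)) (Bs i ∪ Bt i) ⟩
    weight w (edgeSet I (P i)) + weight w (Bs i ∪ Bt i)    ≤⟨ ℚP.+-mono-≤ P-part (weight-∪ w w≥0 (Bs i) (Bt i)) ⟩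
    ℓ i + (weight w (Bs i) + weight w (Bt i))              ≤⟨ ℚP.+-monoʳ-≤ (ℓ i) (ℚP.+-mono-≤ (connections (s-step i)) (connections (t-step i))) ⟩
    ℓ i + (S i + T i)                                      ∎
    where
    open ℚP.≤-Reasoning
    w : Fin m → ℚ
    w = wt i
    w≥0 : ∀ e → 0ℚ ≤ w e
    w≥0 = wt-nonneg i
    P-part : weight w (edgeSet I (P i)) ≤ ℓ i
    P-part = ℚP.≤-trans (weight-path w w≥0 (P i)) (ℚP.≤-reflexive (sym (ℓ-is-cost i)))
    connections : ∀ {G x B} (step : CompStep I G w cls i x B) → weight w B ≤ sum (λ v → weight w (proj₁ step v))
    connections (E , _ , B≡⋃E) = subst (λ B → weight w B ≤ sum (λ v → weight w (E v))) (sym B≡⋃E) (weight-⋃ w w≥0 E)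

  open Potential I (thr ∘ cls) (thr-nonneg ∘ cls)

  -- The path chosen for a component in a connection step of iteration i is
  -- an admissible charge for the potential with weights 2^class: its cost
  -- is at most 2^min(class(i), class(X)) and vanishes if X contains x.
  chosen-path-charge : ∀ {G G'} i x {v} {E : Subset m} → G ⊆ G' → E ⊆ G' → Dec (Reach I G v x) →
    CompChoice I G (wt i) cls i x v E → Charge G G' (ℕ.suc (toℕ i)) i x (weight (wt i) E) v
  chosen-path-charge i _ _ _ _ (inj₂ (_ , E≡⊥)) = inj₁ (ℚP.≤-reflexive (trans (cong (weight (wt i)) E≡⊥) (weight-⊥ (wt i))))
  chosen-path-charge i _ _ _ _ (inj₁ (_ , _ , _ , inj₂ (_ , E≡⊥))) = inj₁ (ℚP.≤-reflexive (trans (cong (weight (wt i)) E≡⊥) (weight-⊥ (wt i))))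
  chosen-path-charge {G} {G'} i x {v} {E} G⊆G' E⊆G' v~x?
    (inj₁ (v-rep , κ , (_ , class-witness) , inj₁ ((_ , Xy' , q , q≤thr) , y , p , (v~y , shortest) , E≡p))) =
    by-class class-witness v~x?
    where
    E≤p : weight (wt i) E ≤ pcost I (wt i) p
    E≤p = subst (λ E' → weight (wt i) E' ≤ pcost I (wt i) p) (sym E≡p) (weight-path (wt i) (wt-nonneg i) p)
    E≤thr : weight (wt i) E ≤ thr (minC (cls i) κ)
    E≤thr = ℚP.≤-trans E≤p (ℚP.≤-trans (shortest _ Xy' q) q≤thr)
    by-class : (κ ≡ nothing ⊎ ∃[ j ] (toℕ j ℕ.≤ toℕ i × comp I G v (s j) × comp I G v (t j) × cls j ≡ κ)) →
               Dec (Reach I G v x) → Charge G G' (ℕ.suc (toℕ i)) i x (weight (wt i) E) v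
    by-class (inj₁ κ≡-∞) _ = inj₁ (ℚP.≤-trans E≤thr (ℚP.≤-trans (thr-minʳ (cls i) κ) (ℚP.≤-reflexive (cong thr κ≡-∞))))
    by-class (inj₂ _) (yes v~x) = inj₁ (ℚP.≤-trans E≤p (shortest x v~x ([] , ([] ∷ []))))
    by-class (inj₂ (j0 , j0≤i , v~sj0 , _ , clsj0≡κ)) (no v≁x) =
      inj₂ (v-rep , reach-trans (path-reach p (subst (_⊆ G') E≡p E⊆G')) (reach-mono G⊆G' (reach-sym v~y)) , v≁x ,
            ℚP.≤-trans E≤thr (thr-minˡ (cls i) κ) , j0 , ℕ.s≤s j0≤i , v~sj0 ,
            ℚP.≤-trans E≤thr (ℚP.≤-trans (thr-minʳ (cls i) κ) (ℚP.≤-reflexive (cong thr (sym clsj0≡κ)))))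

  component⊆step : ∀ {G w i x B} (step : CompStep I G w cls i x B) v → proj₁ step v ⊆ B
  component⊆step (E , _ , B≡⋃E) v e∈Ev = subst (_ ∈_) (sym B≡⋃E) (⋃⁺ E (∈-allFin v) e∈Ev)

  Bs⊆G₂ : ∀ i → Bs i ⊆ G₂ i
  Bs⊆G₂ i = SubsetP.q⊆p∪q (F i) (edgeSet I (P i) ∪ Bs i) ∘ SubsetP.q⊆p∪q (edgeSet I (P i)) (Bs i)

  ℓ-nonneg : ∀ i → 0ℚ ≤ ℓ i
  ℓ-nonneg i = ℚP.≤-trans (thr-nonneg (cls i)) (thr-floor (class-floor i))

  Deciders : Set
  Deciders = ∀ i → ReachDecider (G₁ i) × ReachDecider (G₂ i) × ReachDecider (G₃ i)

  ¬¬-deciders : ¬ ¬ Deciders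
  ¬¬-deciders = ¬¬-∀Fin (λ i → ¬¬-× (¬¬-decider (G₁ i)) (¬¬-× (¬¬-decider (G₂ i)) (¬¬-decider (G₃ i))))

  -- The potential argument: the connections of iteration i are paid for by
  -- the drop of the potential along G₁ i ⊆ G₂ i ⊆ G₃ i, and between
  -- iterations the potential rises by at most 2^class(i+1).
  module Accounting (D : Deciders) where
    D₁ : ∀ i → ReachDecider (G₁ i)
    D₁ i = proj₁ (D i)
    D₂ : ∀ i → ReachDecider (G₂ i)
    D₂ i = proj₁ (proj₂ (D i))
    D₃ : ∀ i → ReachDecider (G₃ i)
    D₃ i = proj₂ (proj₂ (D i))

    Φ₁ Φ₂ Φ₃ : Fin k → ℚ
    Φ₁ i = Leaders.Φ (G₁ i) (D₁ i) (ℕ.suc (toℕ i))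
    Φ₂ i = Leaders.Φ (G₂ i) (D₂ i) (ℕ.suc (toℕ i))
    Φ₃ i = Leaders.Φ (G₃ i) (D₃ i) (ℕ.suc (toℕ i))

    connected₂ : ∀ i → Leaders.Connected (G₂ i) (D₂ i) (ℕ.suc (toℕ i))
    connected₂ i = Growth.connected-grows (G₁ i) (G₂ i) (D₁ i) (D₂ i) (G₁⊆G₂ i) (pairs-connected i)

    connected₃ : ∀ i → Leaders.Connected (G₃ i) (D₃ i) (ℕ.suc (toℕ i))
    connected₃ i = Growth.connected-grows (G₂ i) (G₃ i) (D₂ i) (D₃ i) (G₂⊆G₃ i) (connected₂ i)

    s-paid : ∀ i → Φ₂ i + S i ≤ Φ₁ i
    s-paid i = Growth.Merge.merge (G₁ i) (G₂ i) (D₁ i) (D₂ i) (G₁⊆G₂ i) (pairs-connected i) ℕP.≤-refl reach-refl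
      (λ v → weight (wt i) (Es i v))
      (λ v → chosen-path-charge i (s i) (G₁⊆G₂ i) (Bs⊆G₂ i ∘ component⊆step (s-step i) v) (D₁ i v (s i))
                                (proj₁ (proj₂ (s-step i)) v))

    t-paid : ∀ i → Φ₃ i + T i ≤ Φ₂ i
    t-paid i = Growth.Merge.merge (G₂ i) (G₃ i) (D₂ i) (D₃ i) (G₂⊆G₃ i) (connected₂ i) ℕP.≤-refl
      (reach-mono (G₁⊆G₂ i) (reach-sym (pairs-connected i i ℕP.≤-refl)))
      (λ v → weight (wt i) (Et i v))
      (λ v → chosen-path-charge i (t i) (G₂⊆G₃ i) (SubsetP.q⊆p∪q (G₂ i) (Bt i) ∘ component⊆step (t-step i) v)
                                (D₂ i v (t i)) (proj₁ (proj₂ (t-step i)) v))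

    spend : ∀ i → (S i + T i) + Φ₃ i ≤ Φ₁ i
    spend i = begin
      (S i + T i) + Φ₃ i   ≡⟨ ℚP.+-assoc (S i) (T i) (Φ₃ i) ⟩
      S i + (T i + Φ₃ i)   ≡⟨ cong (_+_ (S i)) (ℚP.+-comm (T i) (Φ₃ i)) ⟩
      S i + (Φ₃ i + T i)   ≤⟨ ℚP.+-monoʳ-≤ (S i) (t-paid i) ⟩
      S i + Φ₂ i           ≡⟨ ℚP.+-comm (S i) (Φ₂ i) ⟩
      Φ₂ i + S i           ≤⟨ s-paid i ⟩
      Φ₁ i                 ∎
      where open ℚP.≤-Reasoning

    rise : ∀ i i' → toℕ i' ≡ ℕ.suc (toℕ i) → Φ₁ i' ≤ Φ₃ i + thr (cls i')
    rise i i' i'≡1+i = ℚP.≤-trans (Leaders.Φ-suc (G₁ i') (D₁ i') i')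
      (ℚP.+-monoˡ-≤ (thr (cls i')) (ℚP.≤-trans (ℚP.≤-reflexive (cong (Leaders.Φ (G₁ i') (D₁ i')) i'≡1+i))
        (Growth.Φ-antitone (G₃ i) (G₁ i') (D₃ i) (D₁ i') (G₃⊆G₁-next i i' i'≡1+i) (connected₃ i))))

    initial : ∀ i → toℕ i ≡ 0 → Φ₁ i ≤ 0ℚ + thr (cls i)
    initial i i≡0 = ℚP.≤-trans (Leaders.Φ-suc (G₁ i) (D₁ i) i)
      (ℚP.≤-reflexive (cong (_+ thr (cls i)) (trans (cong (Leaders.Φ (G₁ i) (D₁ i)) i≡0) (Leaders.Φ-zero (G₁ i) (D₁ i)))))

    connections-cost : sum (λ i → S i + T i) ≤ sum (thr ∘ cls)
    connections-cost = ℚP.≤-trans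
      (telescope (λ i → S i + T i) Φ₁ Φ₃ (thr ∘ cls) 0ℚ ℚP.≤-refl (λ i → Leaders.Φ-nonneg (G₃ i) (D₃ i) _) spend rise initial)
      (ℚP.≤-reflexive (ℚP.+-identityˡ _))

    -- The algorithm pays at most Σ ℓ_i for the paths P i and Σ 2^class(i) ≤ Σ ℓ_i for connections.
    cost-≤-2ℓ : totalCost I r ≤ sumℓ I r + sumℓ I r
    cost-≤-2ℓ = begin
      totalCost I r                          ≡⟨ totalCost-is-sum ⟩
      sum iterationCost                      ≤⟨ sum-mono iteration-cost ⟩
      sum (λ i → ℓ i + (S i + T i))          ≡⟨ ∑-distrib-+ ℓ (λ i → S i + T i) ⟩
      sum ℓ + sum (λ i → S i + T i)          ≤⟨ ℚP.+-monoʳ-≤ (sum ℓ) (ℚP.≤-trans connections-cost (sum-mono (thr-floor ∘ class-floor))) ⟩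
      sum ℓ + sum ℓ                          ≡⟨ sym (cong₂ _+_ (Σℚ≡sum ℓ) (Σℚ≡sum ℓ)) ⟩
      sumℓ I r + sumℓ I r                    ∎
      where open ℚP.≤-Reasoning

  -- The inequality is decidable, so the deciders may be assumed.
  cost-≤-2ℓ : totalCost I r ≤ sumℓ I r + sumℓ I r
  cost-≤-2ℓ = decidable-stable (totalCost I r ℚP.≤? (sumℓ I r + sumℓ I r))
                (¬¬-map Accounting.cost-≤-2ℓ ¬¬-deciders)

  sumℓ-nonneg : 0ℚ ≤ sumℓ I r
  sumℓ-nonneg = subst (0ℚ ≤_) (sym (Σℚ≡sum ℓ)) (sum-nonneg ℓ-nonneg)


lemma6 : (I : Instance) (r : Run I) → totalCost I r ≤ ((+ 9) / 1) * sumℓ I r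
lemma6 I r = ℚP.≤-trans cost-≤-2ℓ (double-≤-nine-times (sumℓ I r) sumℓ-nonneg)
  where open Execution I r
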